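{- Let $f$ be a homogeneous symmetric function of degree $n$ with rational coefficients. If $\omega(f)$ is $p$-positive (i.e. has nonnegative coefficients when expanded in the power sum basis $\{p_\lambda\}_{\lambda\vdash n}$), then $f$ is positively $h$-alternating.
   Context: $\omega$ is the algebra involution of the ring of symmetric functions with $\omega(p_k)=(-1)^{k-1}p_k$ (equivalently $\omega(e_\lambda)=h_\lambda$). A homogeneous symmetric function $f$ of degree $n$ is positively $h$-alternating if, writing $f=\sum_{\lambda\vdash n}c_\lambda\,(-1)^{n-\ell(\lambda)}h_\lambda$ in the complete homogeneous basis, every coefficient $c_\lambda$ is nonnegative; here $\ell(\lambda)$ is the number of parts of $\lambda$. -}

module Defs where

open import Data.Nat as ℕ using (ℕ; zero; suc; _∸_)
import Data.Nat.ListAction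
open import Data.Rational using (ℚ; 0ℚ; 1ℚ; _+_; _*_; -_; _≤_)
open import Data.List using (List; []; _∷_; map; concatMap; upTo; foldr; length)
open import Data.List.Relation.Unary.All using (All)
open import Data.List.Relation.Unary.Linked using (Linked)
open import Data.Vec using (Vec; []; _∷_; zipWith; lookup; tabulate; allFin)
import Data.Vec as Vec
open import Data.Vec.Properties using (≡-dec)
open import Data.Fin using (Fin)
open import Data.Fin.Permutation using (Permutation′; _⟨$⟩ʳ_)
open import Data.Product using (Σ; ∃; _×_; _,_; proj₁; proj₂)
open import Relation.Binary.PropositionalEquality using (_≡_; _≢_)
open import Relation.Nullary.Decidable using (does)
open import Data.Bool using (if_then_else_)

-- Polynomials over ℚ in N variables x₁ … x_N, given by their coefficient
-- function on exponent vectors α ∈ ℕ^N  (f α = coefficient of x^α).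
-- A homogeneous symmetric function of degree n is modelled by its image
-- in n variables (Λⁿ ≅ Λⁿ_N for N ≥ n; here N = n).

Poly : ℕ → Set
Poly N = Vec ℕ N → ℚ

_≈_ : ∀ {N} → Poly N → Poly N → Set
f ≈ g = ∀ α → f α ≡ g α

infix 4 _≈_

sumℚ : List ℚ → ℚ
sumℚ = foldr _+_ 0ℚ

below : ∀ {N} → Vec ℕ N → List (Vec ℕ N)
below [] = [] ∷ []
below (a ∷ α) = concatMap (λ b → map (b ∷_) (below α)) (upTo (suc a))

_·_ : ∀ {N} → Poly N → Poly N → Poly N
(f · g) α = sumℚ (map (λ β → f β * g (zipWith _∸_ α β)) (below α))

one : ∀ {N} → Poly N
one α = if does (≡-dec ℕ._≟_ α (Vec.replicate _ 0)) then 1ℚ else 0ℚ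

_⊙_ : ∀ {N} → ℚ → Poly N → Poly N
(c ⊙ f) α = c * f α

xpow : ∀ {N} → Fin N → ℕ → Vec ℕ N
xpow j k = tabulate (λ i → if does (i Data.Fin.≟ j) then k else 0)

pk : ∀ {N} → ℕ → Poly N
pk {N} k α = sumℚ (Vec.toList (Vec.map (λ j → if does (≡-dec ℕ._≟_ α (xpow j k)) then 1ℚ else 0ℚ) (allFin N)))

hk : ∀ {N} → ℕ → Poly N
hk k α = if does (Vec.sum α ℕ.≟ k) then 1ℚ else 0ℚ

pb : ∀ {N} → List ℕ → Poly N
pb [] = one
pb (k ∷ μ) = pk k · pb μ

hb : ∀ {N} → List ℕ → Poly N
hb [] = one
hb (k ∷ μ) = hk k · hb μ

IsPartition : ℕ → List ℕ → Set
IsPartition n μ = All (λ k → 0 ℕ.< k) μ × Linked ℕ._≥_ μ × Data.Nat.ListAction.sum μ ≡ n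

sgn : ℕ → ℚ
sgn zero = 1ℚ
sgn (suc k) = - sgn k

lin : ∀ {N} → (List ℕ → Poly N) → List (List ℕ × ℚ) → Poly N
lin b [] α = 0ℚ
lin b ((μ , c) ∷ L) α = c * b μ α + lin b L α

permute : ∀ {N} → Permutation′ N → Vec ℕ N → Vec ℕ N
permute σ α = tabulate (λ i → lookup α (σ ⟨$⟩ʳ i))

Symmetric : ∀ {N} → Poly N → Set
Symmetric {N} f = ∀ (σ : Permutation′ N) α → f (permute σ α) ≡ f α

Homogeneous : ∀ {N} → ℕ → Poly N → Set
Homogeneous n f = ∀ α → Vec.sum α ≢ n → f α ≡ 0ℚ

-- ω : the algebra map with ω(p_k) = (-1)^{k-1} p_k, hence
-- ω(p_μ) = ∏_i (-1)^{μ_i - 1} p_μ, extended linearly.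

ωsign : List ℕ → ℚ
ωsign [] = 1ℚ
ωsign (k ∷ μ) = sgn (k ∸ 1) * ωsign μ

-- IsOmega n f g : "g = ω(f)", computed through a p-expansion of f.
IsOmega : ∀ {N} → ℕ → Poly N → Poly N → Set
IsOmega n f g = Σ (List (List ℕ × ℚ)) λ L →
  All (λ x → IsPartition n (proj₁ x)) L ×
  f ≈ lin pb L ×
  g ≈ lin pb (map (λ x → (proj₁ x , ωsign (proj₁ x) * proj₂ x)) L)

PPositive : ∀ {N} → ℕ → Poly N → Set
PPositive n g = Σ (List (List ℕ × ℚ)) λ L →
  All (λ x → IsPartition n (proj₁ x) × 0ℚ ≤ proj₂ x) L ×
  g ≈ lin pb L

PosHAlternating : ∀ {N} → ℕ → Poly N → Set
PosHAlternating n f = Σ (List (List ℕ × ℚ)) λ L →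
  All (λ x → IsPartition n (proj₁ x) × 0ℚ ≤ proj₂ x) L ×
  f ≈ lin (λ μ → sgn (n ∸ length μ) ⊙ hb μ) L

-- ω(p_λ) = ε_λ p_λ with ε_λ = ∏ (-1)^(λᵢ-1), and positively h-alternating functions of
-- degree n are closed under sums, nonnegative multiples and products (degrees adding). Newton's
-- identity k h_k = ∑_{i=1}^k p_i h_{k-i}, multiplied by (-1)^(k-1), writes (-1)^(k-1) p_k as
-- k (-1)^(k-1) h_k plus products of (-1)^(i-1) p_i with (-1)^(k-i-1) h_{k-i}, so by strong induction
-- every ω(p_k), hence every ω(p_λ), is positively h-alternating. If ω(f) = ∑ c_λ p_λ with c_λ ≥ 0,
-- then f = ∑ c_λ ω(p_λ), using that ω is an involution and that the p_λ, λ ⊢ n, are linearly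
-- independent in n variables: p_μ vanishes at x^λ whenever ℓ(μ) ≤ ℓ(λ) and μ ≠ λ, while p_λ(x^λ) > 0.

module Submission where

open import Defs

open import Data.Bool using (Bool; true; false; if_then_else_; _∧_; T)
open import Data.Bool.Properties using (∧-identityʳ; T-≡)
open import Data.Empty using (⊥-elim)
open import Data.Fin using (Fin; zero; suc; toℕ)
import Data.Fin.Properties as FP
open import Data.List as L using (List; []; _∷_; map; concatMap; upTo; length; _++_; applyUpTo)
import Data.List.Properties as LP
open import Data.List.Extrema.Nat using (argmax; f[xs]≤f[argmax]; f[⊥]≤f[argmax]; argmax-sel; argmax-all)
open import Data.List.Relation.Binary.Pointwise using (Pointwise-≡⇒≡)
import Data.List.Relation.Binary.Permutation.Propositional as Perm
import Data.List.Relation.Binary.Permutation.Propositional.Properties as PermP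
open import Data.List.Relation.Unary.All as All using (All; []; _∷_)
import Data.List.Relation.Unary.All.Properties as AllP
open import Data.List.Relation.Unary.Any as Any using (Any; here; there)
open import Data.List.Relation.Unary.Linked as Linked using (Linked; [-])
import Data.List.Relation.Unary.Sorted.TotalOrder.Properties as SortedP
open import Data.Maybe using (Maybe; just; nothing)
open import Data.Nat as ℕ using (ℕ; zero; suc; _∸_; z≤n; s≤s)
open import Data.Nat.Induction using (<-rec)
import Data.Nat.ListAction as ℕL
import Data.Nat.ListAction.Properties as ℕLP
import Data.Nat.Properties as ℕP
open import Data.Product using (Σ; ∃; _×_; _,_; proj₁; proj₂)
open import Data.Rational as Q using (ℚ; 0ℚ; 1ℚ; _+_; _*_; -_)
import Data.Rational.Properties as QP
open import Data.Sum using (inj₁; inj₂)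
open import Data.Vec as V using (Vec; []; _∷_; zipWith; lookup; tabulate; allFin)
import Data.Vec.Properties as VP
open import Function using (_∘_; id)
open import Function.Bundles using (Equivalence)
open import Relation.Binary.Bundles using (TotalOrder)
open import Relation.Binary.Definitions using (tri<; tri≈; tri>)
open import Relation.Binary.PropositionalEquality
import Relation.Binary.Properties.DecTotalOrder as DecTotalOrderProperties
open import Relation.Nullary
open import Relation.Nullary.Decidable using (does)
open import Algebra.Bundles using (CommutativeRing)
open import Algebra.Properties.Group QP.+-0-group using (x∙y⁻¹≈ε⇒x≈y)
open import Algebra.Properties.Semiring.Sum (CommutativeRing.semiring QP.+-*-commutativeRing)
  using (sum; ∑-distrib-+; ∑-comm; *-distribˡ-sum; *-distribʳ-sum; sum-cong-≗; sum-replicate-zero)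
open import Tactic.RingSolver.Core.AlmostCommutativeRing using (AlmostCommutativeRing; fromCommutativeRing)
open import Tactic.RingSolver using (solve-∀)

module ≥ = DecTotalOrderProperties ℕP.≤-decTotalOrder
open import Data.List.Sort ≥.≥-decTotalOrder using (sort; sort-↭; sort-↗)

ℚ-ring : AlmostCommutativeRing _ _
ℚ-ring = fromCommutativeRing QP.+-*-commutativeRing isZero
  where
  isZero : ∀ x → Maybe (0ℚ ≡ x)
  isZero x with 0ℚ Q.≟ x
  ... | yes p = just p
  ... | no _ = nothing

-- Finite sums

sumOver : ∀ {A : Set} → (A → ℚ) → List A → ℚ
sumOver φ l = sumℚ (map φ l)

sumOver-cong : ∀ {A : Set} {φ ψ : A → ℚ} (l : List A) → (∀ x → φ x ≡ ψ x) → sumOver φ l ≡ sumOver ψ l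
sumOver-cong [] e = refl
sumOver-cong (x ∷ l) e = cong₂ _+_ (e x) (sumOver-cong l e)

sumOver-+ : ∀ {A : Set} (φ ψ : A → ℚ) (l : List A) →
  sumOver (λ x → φ x + ψ x) l ≡ sumOver φ l + sumOver ψ l
sumOver-+ φ ψ [] = refl
sumOver-+ φ ψ (x ∷ l) rewrite sumOver-+ φ ψ l = interchange (φ x) (ψ x) (sumOver φ l) (sumOver ψ l)
  where
  interchange : ∀ a b c d → (a + b) + (c + d) ≡ (a + c) + (b + d)
  interchange = solve-∀ ℚ-ring

sumOver-*ˡ : ∀ {A : Set} (c : ℚ) (φ : A → ℚ) (l : List A) → sumOver (λ x → c * φ x) l ≡ c * sumOver φ l
sumOver-*ˡ c φ [] = sym (QP.*-zeroʳ c)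
sumOver-*ˡ c φ (x ∷ l) rewrite sumOver-*ˡ c φ l = sym (QP.*-distribˡ-+ c (φ x) (sumOver φ l))

sumOver-*ʳ : ∀ {A : Set} (c : ℚ) (φ : A → ℚ) (l : List A) → sumOver (λ x → φ x * c) l ≡ sumOver φ l * c
sumOver-*ʳ c φ l =
  trans (sumOver-cong l (λ x → QP.*-comm (φ x) c)) (trans (sumOver-*ˡ c φ l) (QP.*-comm c _))

sumOver-zero : ∀ {A : Set} (φ : A → ℚ) (l : List A) → (∀ x → φ x ≡ 0ℚ) → sumOver φ l ≡ 0ℚ
sumOver-zero φ [] e = refl
sumOver-zero φ (x ∷ l) e rewrite e x | sumOver-zero φ l e = refl

sumOver-++ : ∀ {A : Set} (φ : A → ℚ) (l m : List A) → sumOver φ (l ++ m) ≡ sumOver φ l + sumOver φ m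
sumOver-++ φ [] m = sym (QP.+-identityˡ _)
sumOver-++ φ (x ∷ l) m rewrite sumOver-++ φ l m = sym (QP.+-assoc (φ x) _ _)

sumOver-map : ∀ {A B : Set} (φ : B → ℚ) (g : A → B) (l : List A) → sumOver φ (map g l) ≡ sumOver (φ ∘ g) l
sumOver-map φ g [] = refl
sumOver-map φ g (x ∷ l) rewrite sumOver-map φ g l = refl

sumOver-concatMap : ∀ {A B : Set} (φ : B → ℚ) (g : A → List B) (l : List A) →
  sumOver φ (concatMap g l) ≡ sumOver (λ x → sumOver φ (g x)) l
sumOver-concatMap φ g [] = refl
sumOver-concatMap φ g (x ∷ l)
  rewrite sumOver-++ φ (g x) (concatMap g l) | sumOver-concatMap φ g l = refl

sumOver-tabulate : ∀ N (φ : Fin N → ℚ) → sumℚ (V.toList (tabulate φ)) ≡ sum φ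
sumOver-tabulate zero φ = refl
sumOver-tabulate (suc N) φ = cong (φ zero +_) (sumOver-tabulate N (φ ∘ suc))

sumOver-allFin : ∀ N (φ : Fin N → ℚ) → sumℚ (V.toList (V.map φ (allFin N))) ≡ sum φ
sumOver-allFin N φ =
  trans (cong (λ v → sumℚ (V.toList v)) (sym (VP.tabulate-allFin φ))) (sumOver-tabulate N φ)

sum-zero : ∀ {N} (φ : Fin N → ℚ) → (∀ t → φ t ≡ 0ℚ) → sum φ ≡ 0ℚ
sum-zero {N} φ e = trans (sum-cong-≗ {N} e) (sum-replicate-zero N)

∑ℕ : ℕ → (ℕ → ℚ) → ℚ
∑ℕ n φ = sum (φ ∘ toℕ {n})

sumOver-upTo : ∀ n (φ : ℕ → ℚ) → sumOver φ (upTo n) ≡ ∑ℕ n φ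
sumOver-upTo n φ = go n id
  where
  go : ∀ n (f : ℕ → ℕ) → sumOver φ (applyUpTo f n) ≡ ∑ℕ n (φ ∘ f)
  go zero f = refl
  go (suc n) f = cong (φ (f 0) +_) (go n (f ∘ suc))

∑ℕ-cong : ∀ n {φ ψ : ℕ → ℚ} → (∀ i → i ℕ.< n → φ i ≡ ψ i) → ∑ℕ n φ ≡ ∑ℕ n ψ
∑ℕ-cong n e = sum-cong-≗ {n} (λ i → e (toℕ i) (FP.toℕ<n i))

∑ℕ-cong′ : ∀ n {φ ψ : ℕ → ℚ} → (∀ i → φ i ≡ ψ i) → ∑ℕ n φ ≡ ∑ℕ n ψ
∑ℕ-cong′ n e = sum-cong-≗ {n} (e ∘ toℕ)

∑ℕ-zero : ∀ n (φ : ℕ → ℚ) → (∀ i → i ℕ.< n → φ i ≡ 0ℚ) → ∑ℕ n φ ≡ 0ℚ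
∑ℕ-zero n φ e = sum-zero {n} (φ ∘ toℕ) (λ i → e (toℕ i) (FP.toℕ<n i))

∑ℕ-+ : ∀ n (φ ψ : ℕ → ℚ) → ∑ℕ n (λ i → φ i + ψ i) ≡ ∑ℕ n φ + ∑ℕ n ψ
∑ℕ-+ n φ ψ = ∑-distrib-+ {n} (φ ∘ toℕ) (ψ ∘ toℕ)

∑ℕ-*ˡ : ∀ n (c : ℚ) (φ : ℕ → ℚ) → ∑ℕ n (λ i → c * φ i) ≡ c * ∑ℕ n φ
∑ℕ-*ˡ n c φ = sym (*-distribˡ-sum {n} c (φ ∘ toℕ))

∑ℕ-last : ∀ n (φ : ℕ → ℚ) → ∑ℕ (suc n) φ ≡ ∑ℕ n φ + φ n
∑ℕ-last zero φ = trans (QP.+-identityʳ (φ 0)) (sym (QP.+-identityˡ (φ 0)))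
∑ℕ-last (suc n) φ rewrite ∑ℕ-last n (φ ∘ suc) = sym (QP.+-assoc (φ 0) _ _)

sumOver-∑ℕ : ∀ {A : Set} n (G : ℕ → A → ℚ) (l : List A) →
  sumOver (λ x → ∑ℕ n (λ i → G i x)) l ≡ ∑ℕ n (λ i → sumOver (G i) l)
sumOver-∑ℕ n G [] = sym (∑ℕ-zero n _ (λ _ _ → refl))
sumOver-∑ℕ n G (x ∷ l) rewrite sumOver-∑ℕ n G l = sym (∑ℕ-+ n (λ i → G i x) (λ i → sumOver (G i) l))

-- The polynomial algebra

_∸v_ : ∀ {N} → Vec ℕ N → Vec ℕ N → Vec ℕ N
α ∸v β = zipWith _∸_ α β

-- ∑split α F = ∑_{β + γ = α} F β γ
∑split : ∀ {N} → Vec ℕ N → (Vec ℕ N → Vec ℕ N → ℚ) → ℚ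
∑split α F = sumOver (λ β → F β (α ∸v β)) (below α)

∑split-cons : ∀ {N} a (α : Vec ℕ N) (F : Vec ℕ (suc N) → Vec ℕ (suc N) → ℚ) →
  ∑split (a ∷ α) F ≡ ∑ℕ (suc a) (λ b → ∑split α (λ β γ → F (b ∷ β) ((a ∸ b) ∷ γ)))
∑split-cons a α F = begin
    sumOver (λ β → F β ((a ∷ α) ∸v β)) (concatMap (λ b → map (b ∷_) (below α)) (upTo (suc a)))
  ≡⟨ sumOver-concatMap (λ β → F β ((a ∷ α) ∸v β)) (λ b → map (b ∷_) (below α)) (upTo (suc a)) ⟩
    sumOver (λ b → sumOver (λ β → F β ((a ∷ α) ∸v β)) (map (b ∷_) (below α))) (upTo (suc a))
  ≡⟨ sumOver-cong (upTo (suc a)) (λ b → sumOver-map (λ β → F β ((a ∷ α) ∸v β)) (b ∷_) (below α)) ⟩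
    sumOver (λ b → ∑split α (λ β γ → F (b ∷ β) ((a ∸ b) ∷ γ))) (upTo (suc a))
  ≡⟨ sumOver-upTo (suc a) (λ b → ∑split α (λ β γ → F (b ∷ β) ((a ∸ b) ∷ γ))) ⟩
    ∑ℕ (suc a) (λ b → ∑split α (λ β γ → F (b ∷ β) ((a ∸ b) ∷ γ)))
  ∎
  where open ≡-Reasoning

∑split-cong : ∀ {N} (α : Vec ℕ N) {F G} → (∀ β γ → F β γ ≡ G β γ) → ∑split α F ≡ ∑split α G
∑split-cong α e = sumOver-cong (below α) (λ β → e β _)

∑split-+ : ∀ {N} (α : Vec ℕ N) (F G : Vec ℕ N → Vec ℕ N → ℚ) →
  ∑split α (λ β γ → F β γ + G β γ) ≡ ∑split α F + ∑split α G
∑split-+ α F G = sumOver-+ (λ β → F β (α ∸v β)) (λ β → G β (α ∸v β)) (below α)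

∑split-*ˡ : ∀ {N} (α : Vec ℕ N) c (F : Vec ℕ N → Vec ℕ N → ℚ) →
  ∑split α (λ β γ → c * F β γ) ≡ c * ∑split α F
∑split-*ˡ α c F = sumOver-*ˡ c (λ β → F β (α ∸v β)) (below α)

∑split-*ʳ : ∀ {N} (α : Vec ℕ N) c (F : Vec ℕ N → Vec ℕ N → ℚ) →
  ∑split α (λ β γ → F β γ * c) ≡ ∑split α F * c
∑split-*ʳ α c F = sumOver-*ʳ c (λ β → F β (α ∸v β)) (below α)

∑split-zero : ∀ {N} (α : Vec ℕ N) (F : Vec ℕ N → Vec ℕ N → ℚ) → (∀ β γ → F β γ ≡ 0ℚ) → ∑split α F ≡ 0ℚ
∑split-zero α F e = sumOver-zero (λ β → F β (α ∸v β)) (below α) (λ β → e β _)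

∑split-∑ℕ : ∀ {N} (α : Vec ℕ N) n (G : ℕ → Vec ℕ N → Vec ℕ N → ℚ) →
  ∑split α (λ β γ → ∑ℕ n (λ i → G i β γ)) ≡ ∑ℕ n (λ i → ∑split α (G i))
∑split-∑ℕ α n G = sumOver-∑ℕ n (λ i β → G i β (α ∸v β)) (below α)

∑split-sum : ∀ {M} (α : Vec ℕ M) N (G : Fin N → Vec ℕ M → Vec ℕ M → ℚ) →
  ∑split α (λ β γ → sum (λ t → G t β γ)) ≡ sum (λ t → ∑split α (G t))
∑split-sum α zero G = ∑split-zero α (λ _ _ → 0ℚ) (λ _ _ → refl)
∑split-sum α (suc N) G = trans (∑split-+ α (G zero) (λ β γ → sum (λ t → G (suc t) β γ)))
  (cong (∑split α (G zero) +_) (∑split-sum α N (G ∘ suc)))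

∑ℕ-reverse : ∀ a (K : ℕ → ℕ → ℚ) → ∑ℕ (suc a) (λ b → K b (a ∸ b)) ≡ ∑ℕ (suc a) (λ b → K (a ∸ b) b)
∑ℕ-reverse zero K = refl
∑ℕ-reverse (suc a) K = begin
    K 0 (suc a) + ∑ℕ (suc a) (λ b → K (suc b) (a ∸ b))
  ≡⟨ cong (K 0 (suc a) +_) (∑ℕ-reverse a (λ x y → K (suc x) y)) ⟩
    K 0 (suc a) + ∑ℕ (suc a) (λ b → K (suc (a ∸ b)) b)
  ≡⟨ QP.+-comm (K 0 (suc a)) _ ⟩
    ∑ℕ (suc a) (λ b → K (suc (a ∸ b)) b) + K 0 (suc a)
  ≡⟨ cong₂ _+_ (∑ℕ-cong (suc a) (λ b b≤a → cong (λ z → K z b) (sym (ℕP.+-∸-assoc 1 (ℕP.≤-pred b≤a)))))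
               (cong (λ z → K z (suc a)) (sym (ℕP.n∸n≡0 a))) ⟩
    ∑ℕ (suc a) (λ b → K (suc a ∸ b) b) + K (suc a ∸ suc a) (suc a)
  ≡⟨ ∑ℕ-last (suc a) (λ b → K (suc a ∸ b) b) ⟨
    ∑ℕ (suc (suc a)) (λ b → K (suc a ∸ b) b)
  ∎
  where open ≡-Reasoning

∑split-swap : ∀ {N} (α : Vec ℕ N) (F : Vec ℕ N → Vec ℕ N → ℚ) → ∑split α F ≡ ∑split α (λ β γ → F γ β)
∑split-swap [] F = refl
∑split-swap (a ∷ α) F = begin
    ∑split (a ∷ α) F
  ≡⟨ ∑split-cons a α F ⟩
    ∑ℕ (suc a) (λ b → ∑split α (λ β γ → F (b ∷ β) ((a ∸ b) ∷ γ)))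
  ≡⟨ ∑ℕ-cong′ (suc a) (λ b → ∑split-swap α (λ β γ → F (b ∷ β) ((a ∸ b) ∷ γ))) ⟩
    ∑ℕ (suc a) (λ b → ∑split α (λ β γ → F (b ∷ γ) ((a ∸ b) ∷ β)))
  ≡⟨ ∑ℕ-reverse a (λ x y → ∑split α (λ β γ → F (x ∷ γ) (y ∷ β))) ⟩
    ∑ℕ (suc a) (λ b → ∑split α (λ β γ → F ((a ∸ b) ∷ γ) (b ∷ β)))
  ≡⟨ ∑split-cons a α (λ β γ → F γ β) ⟨
    ∑split (a ∷ α) (λ β γ → F γ β)
  ∎
  where open ≡-Reasoning

·-comm : ∀ {N} (f g : Poly N) → (f · g) ≈ (g · f)
·-comm f g α = trans (∑split-swap α (λ β γ → f β * g γ)) (∑split-cong α (λ β γ → QP.*-comm (f γ) (g β)))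

∑ℕ-triangle : ∀ a (K : ℕ → ℕ → ℕ → ℚ) →
  ∑ℕ (suc a) (λ b → ∑ℕ (suc b) (λ c → K c (b ∸ c) (a ∸ b))) ≡
  ∑ℕ (suc a) (λ c → ∑ℕ (suc (a ∸ c)) (λ e → K c e ((a ∸ c) ∸ e)))
∑ℕ-triangle zero K = refl
∑ℕ-triangle (suc a) K = begin
    (K 0 0 (suc a) + 0ℚ) + ∑ℕ (suc a) (λ b → x b + z b)
  ≡⟨ cong ((K 0 0 (suc a) + 0ℚ) +_) (∑ℕ-+ (suc a) x z) ⟩
    (K 0 0 (suc a) + 0ℚ) + (∑ℕ (suc a) x + ∑ℕ (suc a) z)
  ≡⟨ cong (λ s → (K 0 0 (suc a) + 0ℚ) + (∑ℕ (suc a) x + s)) (∑ℕ-triangle a (λ c → K (suc c))) ⟩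
    (K 0 0 (suc a) + 0ℚ) + (∑ℕ (suc a) x + Y)
  ≡⟨ regroup (K 0 0 (suc a)) (∑ℕ (suc a) x) Y ⟩
    (K 0 0 (suc a) + ∑ℕ (suc a) x) + Y
  ∎
  where
  open ≡-Reasoning
  x z : ℕ → ℚ
  x b = K 0 (suc b) (a ∸ b)
  z b = ∑ℕ (suc b) (λ c → K (suc c) (b ∸ c) (a ∸ b))
  Y = ∑ℕ (suc a) (λ c → ∑ℕ (suc (a ∸ c)) (λ e → K (suc c) e ((a ∸ c) ∸ e)))
  regroup : ∀ p x y → (p + 0ℚ) + (x + y) ≡ (p + x) + y
  regroup = solve-∀ ℚ-ring

∑split-assoc : ∀ {N} (α : Vec ℕ N) (F : Vec ℕ N → Vec ℕ N → Vec ℕ N → ℚ) →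
  ∑split α (λ β δ → ∑split β (λ γ ε → F γ ε δ)) ≡ ∑split α (λ γ η → ∑split η (λ ε δ → F γ ε δ))
∑split-assoc [] F = refl
∑split-assoc (a ∷ α) F = begin
    ∑split (a ∷ α) (λ β δ → ∑split β (λ γ ε → F γ ε δ))
  ≡⟨ ∑split-cons a α (λ β δ → ∑split β (λ γ ε → F γ ε δ)) ⟩
    ∑ℕ (suc a) (λ b → ∑split α (λ β δ → ∑split (b ∷ β) (λ γ ε → F γ ε ((a ∸ b) ∷ δ))))
  ≡⟨ ∑ℕ-cong′ (suc a) (λ b → ∑split-cong α (λ β δ → ∑split-cons b β (λ γ ε → F γ ε ((a ∸ b) ∷ δ)))) ⟩
    ∑ℕ (suc a) (λ b → ∑split α (λ β δ → ∑ℕ (suc b) (λ c → ∑split β (λ γ ε → F′ c (b ∸ c) (a ∸ b) γ ε δ))))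
  ≡⟨ ∑ℕ-cong′ (suc a) (λ b → ∑split-∑ℕ α (suc b) (λ c β δ → ∑split β (λ γ ε → F′ c (b ∸ c) (a ∸ b) γ ε δ))) ⟩
    ∑ℕ (suc a) (λ b → ∑ℕ (suc b) (λ c → ∑split α (λ β δ → ∑split β (λ γ ε → F′ c (b ∸ c) (a ∸ b) γ ε δ))))
  ≡⟨ ∑ℕ-cong′ (suc a) (λ b → ∑ℕ-cong′ (suc b) (λ c → ∑split-assoc α (F′ c (b ∸ c) (a ∸ b)))) ⟩
    ∑ℕ (suc a) (λ b → ∑ℕ (suc b) (λ c → K c (b ∸ c) (a ∸ b)))
  ≡⟨ ∑ℕ-triangle a K ⟩
    ∑ℕ (suc a) (λ c → ∑ℕ (suc (a ∸ c)) (λ e → K c e ((a ∸ c) ∸ e)))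
  ≡⟨ ∑ℕ-cong′ (suc a) (λ c → ∑split-∑ℕ α (suc (a ∸ c)) (λ e γ η → ∑split η (λ ε δ → F′ c e ((a ∸ c) ∸ e) γ ε δ))) ⟨
    ∑ℕ (suc a) (λ c → ∑split α (λ γ η → ∑ℕ (suc (a ∸ c)) (λ e → ∑split η (λ ε δ → F′ c e ((a ∸ c) ∸ e) γ ε δ))))
  ≡⟨ ∑ℕ-cong′ (suc a) (λ c → ∑split-cong α (λ γ η → ∑split-cons (a ∸ c) η (λ ε δ → F (c ∷ γ) ε δ))) ⟨
    ∑ℕ (suc a) (λ c → ∑split α (λ γ η → ∑split ((a ∸ c) ∷ η) (λ ε δ → F (c ∷ γ) ε δ)))
  ≡⟨ ∑split-cons a α (λ γ η → ∑split η (λ ε δ → F γ ε δ)) ⟨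
    ∑split (a ∷ α) (λ γ η → ∑split η (λ ε δ → F γ ε δ))
  ∎
  where
  open ≡-Reasoning
  F′ : ℕ → ℕ → ℕ → Vec ℕ _ → Vec ℕ _ → Vec ℕ _ → ℚ
  F′ c e d γ ε δ = F (c ∷ γ) (e ∷ ε) (d ∷ δ)
  K : ℕ → ℕ → ℕ → ℚ
  K c e d = ∑split α (λ γ η → ∑split η (λ ε δ → F′ c e d γ ε δ))

·-assoc : ∀ {N} (f g h : Poly N) → ((f · g) · h) ≈ (f · (g · h))
·-assoc f g h α = begin
    ((f · g) · h) α
  ≡⟨ ∑split-cong α (λ β δ → ∑split-*ʳ β (h δ) (λ γ ε → f γ * g ε)) ⟨
    ∑split α (λ β δ → ∑split β (λ γ ε → (f γ * g ε) * h δ))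
  ≡⟨ ∑split-assoc α (λ γ ε δ → (f γ * g ε) * h δ) ⟩
    ∑split α (λ γ η → ∑split η (λ ε δ → (f γ * g ε) * h δ))
  ≡⟨ ∑split-cong α (λ γ η → trans (∑split-cong η (λ ε δ → QP.*-assoc (f γ) (g ε) (h δ)))
                                    (∑split-*ˡ η (f γ) (λ ε δ → g ε * h δ))) ⟩
    (f · (g · h)) α
  ∎
  where open ≡-Reasoning

≈-sym : ∀ {N} {f g : Poly N} → f ≈ g → g ≈ f
≈-sym e α = sym (e α)

≈-trans : ∀ {N} {f g h : Poly N} → f ≈ g → g ≈ h → f ≈ h
≈-trans e e′ α = trans (e α) (e′ α)

·-congˡ : ∀ {N} {f f′ : Poly N} (g : Poly N) → f ≈ f′ → (f · g) ≈ (f′ · g)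
·-congˡ g e α = ∑split-cong α (λ β γ → cong (_* g γ) (e β))

·-congʳ : ∀ {N} (f : Poly N) {g g′ : Poly N} → g ≈ g′ → (f · g) ≈ (f · g′)
·-congʳ f e α = ∑split-cong α (λ β γ → cong (f β *_) (e γ))

oneAt : ℕ → ℚ
oneAt zero = 1ℚ
oneAt (suc _) = 0ℚ

one-cons : ∀ {N} b (β : Vec ℕ N) → one (b ∷ β) ≡ oneAt b * one β
one-cons zero β = sym (QP.*-identityˡ (one β))
one-cons (suc b) β = sym (QP.*-zeroˡ (one β))

∑ℕ-oneAt : ∀ a (G : ℕ → ℚ) → ∑ℕ (suc a) (λ b → oneAt (a ∸ b) * G b) ≡ G a
∑ℕ-oneAt zero G = trans (QP.+-identityʳ _) (QP.*-identityˡ (G 0))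
∑ℕ-oneAt (suc a) G = trans (cong₂ _+_ (QP.*-zeroˡ (G 0)) (∑ℕ-oneAt a (G ∘ suc))) (QP.+-identityˡ _)

·-identityʳ : ∀ {N} (f : Poly N) → (f · one) ≈ f
·-identityʳ f [] = trans (QP.+-identityʳ _) (QP.*-identityʳ (f []))
·-identityʳ f (a ∷ α) = begin
    ∑split (a ∷ α) (λ β γ → f β * one γ)
  ≡⟨ ∑split-cons a α (λ β γ → f β * one γ) ⟩
    ∑ℕ (suc a) (λ b → ∑split α (λ β γ → f (b ∷ β) * one ((a ∸ b) ∷ γ)))
  ≡⟨ ∑ℕ-cong′ (suc a) (λ b → ∑split-cong α (λ β γ →
        trans (cong (f (b ∷ β) *_) (one-cons (a ∸ b) γ)) (exchange (f (b ∷ β)) (oneAt (a ∸ b)) (one γ)))) ⟩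
    ∑ℕ (suc a) (λ b → ∑split α (λ β γ → oneAt (a ∸ b) * (f (b ∷ β) * one γ)))
  ≡⟨ ∑ℕ-cong′ (suc a) (λ b → ∑split-*ˡ α (oneAt (a ∸ b)) (λ β γ → f (b ∷ β) * one γ)) ⟩
    ∑ℕ (suc a) (λ b → oneAt (a ∸ b) * ((λ β → f (b ∷ β)) · one) α)
  ≡⟨ ∑ℕ-cong′ (suc a) (λ b → cong (oneAt (a ∸ b) *_) (·-identityʳ (λ β → f (b ∷ β)) α)) ⟩
    ∑ℕ (suc a) (λ b → oneAt (a ∸ b) * f (b ∷ α))
  ≡⟨ ∑ℕ-oneAt a (λ b → f (b ∷ α)) ⟩
    f (a ∷ α)
  ∎
  where
  open ≡-Reasoning
  exchange : ∀ x d o → x * (d * o) ≡ d * (x * o)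
  exchange = solve-∀ ℚ-ring

⊙-·ˡ : ∀ {N} c (f g : Poly N) → ((c ⊙ f) · g) ≈ (c ⊙ (f · g))
⊙-·ˡ c f g α = trans (∑split-cong α (λ β γ → QP.*-assoc c (f β) (g γ))) (∑split-*ˡ α c (λ β γ → f β * g γ))

⊙-·ʳ : ∀ {N} c (f g : Poly N) → (f · (c ⊙ g)) ≈ (c ⊙ (f · g))
⊙-·ʳ c f g α = trans (∑split-cong α (λ β γ → exchange (f β) c (g γ))) (∑split-*ˡ α c (λ β γ → f β * g γ))
  where
  exchange : ∀ x c y → x * (c * y) ≡ c * (x * y)
  exchange = solve-∀ ℚ-ring

Coeffs : Set
Coeffs = List (List ℕ × ℚ)

rescale : (List ℕ → ℚ) → Coeffs → Coeffs
rescale s = map (λ x → (proj₁ x , s (proj₁ x) * proj₂ x))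

lin-++ : ∀ {N} (b : List ℕ → Poly N) L M α → lin b (L ++ M) α ≡ lin b L α + lin b M α
lin-++ b [] M α = sym (QP.+-identityˡ _)
lin-++ b ((μ , c) ∷ L) M α rewrite lin-++ b L M α = sym (QP.+-assoc (c * b μ α) _ _)

lin-rescale : ∀ {N} (b : List ℕ → Poly N) s L α → lin b (rescale s L) α ≡ lin (λ μ → s μ ⊙ b μ) L α
lin-rescale b s [] α = refl
lin-rescale b s ((μ , c) ∷ L) α rewrite lin-rescale b s L α = cong (_+ _) (reassoc (s μ) c (b μ α))
  where
  reassoc : ∀ s c x → s * c * x ≡ c * (s * x)
  reassoc = solve-∀ ℚ-ring

lin-⊙ : ∀ {N} (b : List ℕ → Poly N) c L α → lin (λ μ → c ⊙ b μ) L α ≡ c * lin b L α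
lin-⊙ b c [] α = sym (QP.*-zeroʳ c)
lin-⊙ b c ((μ , d) ∷ L) α rewrite lin-⊙ b c L α = factor c d (b μ α) (lin b L α)
  where
  factor : ∀ c d x y → d * (c * x) + c * y ≡ c * (d * x + y)
  factor = solve-∀ ℚ-ring

lin-cong : ∀ {N} {b b′ : List ℕ → Poly N} → (∀ μ → b μ ≈ b′ μ) → ∀ L → lin b L ≈ lin b′ L
lin-cong e [] α = refl
lin-cong e ((μ , c) ∷ L) α = cong₂ _+_ (cong (c *_) (e μ α)) (lin-cong e L α)

lin-·ˡ : ∀ {N} (b : List ℕ → Poly N) L (g : Poly N) → (lin b L · g) ≈ lin (λ μ → b μ · g) L
lin-·ˡ b [] g α = ∑split-zero α (λ β γ → 0ℚ * g γ) (λ β γ → QP.*-zeroˡ (g γ))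
lin-·ˡ b ((μ , c) ∷ L) g α = begin
    ∑split α (λ β γ → (c * b μ β + lin b L β) * g γ)
  ≡⟨ ∑split-cong α (λ β γ → distrib c (b μ β) (lin b L β) (g γ)) ⟩
    ∑split α (λ β γ → c * (b μ β * g γ) + lin b L β * g γ)
  ≡⟨ ∑split-+ α (λ β γ → c * (b μ β * g γ)) (λ β γ → lin b L β * g γ) ⟩
    ∑split α (λ β γ → c * (b μ β * g γ)) + ∑split α (λ β γ → lin b L β * g γ)
  ≡⟨ cong₂ _+_ (∑split-*ˡ α c (λ β γ → b μ β * g γ)) (lin-·ˡ b L g α) ⟩
    c * (b μ · g) α + lin (λ μ → b μ · g) L α
  ∎
  where
  open ≡-Reasoning
  distrib : ∀ c x y z → (c * x + y) * z ≡ c * (x * z) + y * z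
  distrib = solve-∀ ℚ-ring

lin-·ʳ : ∀ {N} (b : List ℕ → Poly N) L (g : Poly N) → (g · lin b L) ≈ lin (λ μ → g · b μ) L
lin-·ʳ b L g = ≈-trans (·-comm g (lin b L))
  (≈-trans (lin-·ˡ b L g) (lin-cong (λ μ → ·-comm (b μ) g) L))

-- Power sums and complete homogeneous functions

𝟙 : Bool → ℚ
𝟙 b = if b then 1ℚ else 0ℚ

fromℕ : ℕ → ℚ
fromℕ zero = 0ℚ
fromℕ (suc n) = 1ℚ + fromℕ n

fromℕ-+ : ∀ a b → fromℕ (a ℕ.+ b) ≡ fromℕ a + fromℕ b
fromℕ-+ zero b = sym (QP.+-identityˡ _)
fromℕ-+ (suc a) b rewrite fromℕ-+ a b = sym (QP.+-assoc 1ℚ (fromℕ a) (fromℕ b))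

δᵛ : ∀ {N} → Vec ℕ N → Vec ℕ N → ℚ
δᵛ u v = 𝟙 (does (VP.≡-dec ℕ._≟_ u v))

δᵛ-cons : ∀ {N} b c (β v : Vec ℕ N) → δᵛ (b ∷ β) (c ∷ v) ≡ 𝟙 (b ℕ.≡ᵇ c) * δᵛ β v
δᵛ-cons b c β v with b ℕ.≡ᵇ c
... | true = sym (QP.*-identityˡ (δᵛ β v))
... | false = sym (QP.*-zeroˡ (δᵛ β v))

_≤ᵛᵇ_ : ∀ {N} → Vec ℕ N → Vec ℕ N → Bool
[] ≤ᵛᵇ [] = true
(c ∷ v) ≤ᵛᵇ (a ∷ α) = (c ℕ.≤ᵇ a) ∧ (v ≤ᵛᵇ α)

≤ᵇ-suc : ∀ c a → (suc c ℕ.≤ᵇ suc a) ≡ (c ℕ.≤ᵇ a)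
≤ᵇ-suc zero a = refl
≤ᵇ-suc (suc c) a = refl

≤ᵇ⇒≤ : ∀ {m n} → (m ℕ.≤ᵇ n) ≡ true → m ℕ.≤ n
≤ᵇ⇒≤ {m} {n} e = ℕP.≤ᵇ⇒≤ m n (subst T (sym e) _)

∑ℕ-δ : ∀ a c (G : ℕ → ℚ) → ∑ℕ (suc a) (λ b → 𝟙 (b ℕ.≡ᵇ c) * G b) ≡ (if c ℕ.≤ᵇ a then G c else 0ℚ)
∑ℕ-δ zero zero G = trans (QP.+-identityʳ _) (QP.*-identityˡ (G 0))
∑ℕ-δ zero (suc c) G = trans (QP.+-identityʳ _) (QP.*-zeroˡ (G 0))
∑ℕ-δ (suc a) zero G =
  trans (cong₂ _+_ (QP.*-identityˡ (G 0)) (∑ℕ-zero (suc a) _ (λ i _ → QP.*-zeroˡ (G (suc i)))))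
        (QP.+-identityʳ _)
∑ℕ-δ (suc a) (suc c) G = trans (cong₂ _+_ (QP.*-zeroˡ (G 0)) (∑ℕ-δ a c (G ∘ suc)))
  (trans (QP.+-identityˡ _) (cong (λ z → if z then G (suc c) else 0ℚ) (sym (≤ᵇ-suc c a))))

∑split-δ : ∀ {N} (α v : Vec ℕ N) (F : Vec ℕ N → Vec ℕ N → ℚ) →
  ∑split α (λ β γ → δᵛ β v * F β γ) ≡ (if v ≤ᵛᵇ α then F v (α ∸v v) else 0ℚ)
∑split-δ [] [] F = trans (QP.+-identityʳ _) (QP.*-identityˡ _)
∑split-δ (a ∷ α) (c ∷ v) F = begin
    ∑split (a ∷ α) (λ β γ → δᵛ β (c ∷ v) * F β γ)
  ≡⟨ ∑split-cons a α (λ β γ → δᵛ β (c ∷ v) * F β γ) ⟩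
    ∑ℕ (suc a) (λ b → ∑split α (λ β γ → δᵛ (b ∷ β) (c ∷ v) * F′ b β γ))
  ≡⟨ ∑ℕ-cong′ (suc a) (λ b → ∑split-cong α (λ β γ →
        trans (cong (_* F′ b β γ) (δᵛ-cons b c β v)) (QP.*-assoc (𝟙 (b ℕ.≡ᵇ c)) _ _))) ⟩
    ∑ℕ (suc a) (λ b → ∑split α (λ β γ → 𝟙 (b ℕ.≡ᵇ c) * (δᵛ β v * F′ b β γ)))
  ≡⟨ ∑ℕ-cong′ (suc a) (λ b → trans (∑split-*ˡ α (𝟙 (b ℕ.≡ᵇ c)) (λ β γ → δᵛ β v * F′ b β γ))
        (cong (𝟙 (b ℕ.≡ᵇ c) *_) (∑split-δ α v (F′ b)))) ⟩
    ∑ℕ (suc a) (λ b → 𝟙 (b ℕ.≡ᵇ c) * (if v ≤ᵛᵇ α then F′ b v (α ∸v v) else 0ℚ))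
  ≡⟨ ∑ℕ-δ a c (λ b → if v ≤ᵛᵇ α then F′ b v (α ∸v v) else 0ℚ) ⟩
    (if c ℕ.≤ᵇ a then (if v ≤ᵛᵇ α then F′ c v (α ∸v v) else 0ℚ) else 0ℚ)
  ≡⟨ if-∧ (c ℕ.≤ᵇ a) ⟩
    (if (c ∷ v) ≤ᵛᵇ (a ∷ α) then F (c ∷ v) ((a ∷ α) ∸v (c ∷ v)) else 0ℚ)
  ∎
  where
  open ≡-Reasoning
  F′ : ℕ → _ → _ → ℚ
  F′ b β γ = F (b ∷ β) ((a ∸ b) ∷ γ)
  if-∧ : ∀ x → (if x then (if v ≤ᵛᵇ α then F′ c v (α ∸v v) else 0ℚ) else 0ℚ) ≡
               (if (x ∧ (v ≤ᵛᵇ α)) then F′ c v (α ∸v v) else 0ℚ)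
  if-∧ true = refl
  if-∧ false = refl

pk-· : ∀ {N} k (X : Poly N) α →
  (pk k · X) α ≡ sum (λ t → if xpow t k ≤ᵛᵇ α then X (α ∸v xpow t k) else 0ℚ)
pk-· {N} k X α = begin
    ∑split α (λ β γ → pk k β * X γ)
  ≡⟨ ∑split-cong α (λ β γ → trans (cong (_* X γ) (sumOver-allFin N (λ t → δᵛ β (xpow t k))))
                                   (*-distribʳ-sum {N} (X γ) (λ t → δᵛ β (xpow t k)))) ⟩
    ∑split α (λ β γ → sum (λ t → δᵛ β (xpow t k) * X γ))
  ≡⟨ ∑split-sum α N (λ t β γ → δᵛ β (xpow t k) * X γ) ⟩
    sum (λ t → ∑split α (λ β γ → δᵛ β (xpow t k) * X γ))
  ≡⟨ sum-cong-≗ {N} (λ t → ∑split-δ α (xpow t k) (λ β γ → X γ)) ⟩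
    sum (λ t → if xpow t k ≤ᵛᵇ α then X (α ∸v xpow t k) else 0ℚ)
  ∎
  where open ≡-Reasoning

zeros : ∀ N → Vec ℕ N
zeros N = tabulate (λ _ → 0)

zeros-≤ᵛᵇ : ∀ {N} (α : Vec ℕ N) → (zeros N ≤ᵛᵇ α) ≡ true
zeros-≤ᵛᵇ [] = refl
zeros-≤ᵛᵇ (a ∷ α) = zeros-≤ᵛᵇ α

∸v-zeros : ∀ {N} (α : Vec ℕ N) → α ∸v zeros N ≡ α
∸v-zeros [] = refl
∸v-zeros (a ∷ α) = cong (a ∷_) (∸v-zeros α)

xpow-≤ᵛᵇ : ∀ {N} (t : Fin N) k (α : Vec ℕ N) → (xpow t k ≤ᵛᵇ α) ≡ (k ℕ.≤ᵇ lookup α t)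
xpow-≤ᵛᵇ zero k (a ∷ α) rewrite zeros-≤ᵛᵇ α = ∧-identityʳ _
xpow-≤ᵛᵇ (suc t) k (a ∷ α) = xpow-≤ᵛᵇ t k α

lookup≤sum : ∀ {N} (α : Vec ℕ N) t → lookup α t ℕ.≤ V.sum α
lookup≤sum (a ∷ α) zero = ℕP.m≤m+n a _
lookup≤sum (a ∷ α) (suc t) = ℕP.≤-trans (lookup≤sum α t) (ℕP.m≤n+m _ a)

sum-∸v-xpow : ∀ {N} (α : Vec ℕ N) t k → k ℕ.≤ lookup α t → V.sum (α ∸v xpow t k) ≡ V.sum α ∸ k
sum-∸v-xpow (a ∷ α) zero k k≤a rewrite ∸v-zeros α = sym (ℕP.+-∸-comm (V.sum α) k≤a)
sum-∸v-xpow (a ∷ α) (suc t) k k≤α rewrite sum-∸v-xpow α t k k≤α =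
  sym (ℕP.+-∸-assoc a (ℕP.≤-trans k≤α (lookup≤sum α t)))

sum-fromℕ : ∀ {N} (α : Vec ℕ N) → sum (λ t → fromℕ (lookup α t)) ≡ fromℕ (V.sum α)
sum-fromℕ [] = refl
sum-fromℕ (a ∷ α) = trans (cong (fromℕ a +_) (sum-fromℕ α)) (sym (fromℕ-+ a (V.sum α)))

∑ℕ-count : ∀ k a → a ℕ.≤ k → ∑ℕ k (λ i → 𝟙 (suc i ℕ.≤ᵇ a)) ≡ fromℕ a
∑ℕ-count zero zero a≤k = refl
∑ℕ-count (suc k) zero a≤k = trans (QP.+-identityˡ _) (∑ℕ-zero k _ (λ _ _ → refl))
∑ℕ-count (suc k) (suc a) (s≤s a≤k) =
  cong (1ℚ +_) (trans (∑ℕ-cong′ k (λ i → cong 𝟙 (≤ᵇ-suc (suc i) a))) (∑ℕ-count k a a≤k))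

hk-degree : ∀ {N} k (α : Vec ℕ N) → V.sum α ≡ k → hk k α ≡ 1ℚ
hk-degree k α e with V.sum α ℕ.≡ᵇ k | ℕP.≡⇒≡ᵇ (V.sum α) k e
... | true | _ = refl
... | false | ()

hk-off-degree : ∀ {N} k (α : Vec ℕ N) → V.sum α ≢ k → hk k α ≡ 0ℚ
hk-off-degree k α ne with V.sum α ℕ.≡ᵇ k in eq
... | true = ⊥-elim (ne (ℕP.≡ᵇ⇒≡ (V.sum α) k (subst T (sym eq) _)))
... | false = refl

hk-shift : ∀ {N} k j (α : Vec ℕ N) t → j ℕ.≤ k → j ℕ.≤ lookup α t →
  hk (k ∸ j) (α ∸v xpow t j) ≡ hk k α
hk-shift k j α t j≤k j≤α with V.sum α ℕ.≟ k
... | yes e = trans (hk-degree (k ∸ j) (α ∸v xpow t j) (trans (sum-∸v-xpow α t j j≤α) (cong (_∸ j) e)))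
                    (sym (hk-degree k α e))
... | no ne = trans (hk-off-degree (k ∸ j) (α ∸v xpow t j) (λ e → ne (begin
        V.sum α                 ≡⟨ ℕP.m∸n+n≡m (ℕP.≤-trans j≤α (lookup≤sum α t)) ⟨
        (V.sum α ∸ j) ℕ.+ j     ≡⟨ cong (ℕ._+ j) (trans (sym (sum-∸v-xpow α t j j≤α)) e) ⟩
        (k ∸ j) ℕ.+ j           ≡⟨ ℕP.m∸n+n≡m j≤k ⟩
        k                       ∎)))
                    (sym (hk-off-degree k α ne))
  where open ≡-Reasoning

pk-·-hk : ∀ {N} k i (α : Vec ℕ N) → i ℕ.< k →
  (pk (suc i) · hk (k ∸ suc i)) α ≡ sum (λ t → 𝟙 (suc i ℕ.≤ᵇ lookup α t)) * hk k α
pk-·-hk {N} k i α i<k = trans (pk-· (suc i) (hk (k ∸ suc i)) α)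
  (trans (sum-cong-≗ {N} term) (sym (*-distribʳ-sum {N} (hk k α) _)))
  where
  term : ∀ t → (if xpow t (suc i) ≤ᵛᵇ α then hk (k ∸ suc i) (α ∸v xpow t (suc i)) else 0ℚ)
               ≡ 𝟙 (suc i ℕ.≤ᵇ lookup α t) * hk k α
  term t rewrite xpow-≤ᵛᵇ t (suc i) α with suc i ℕ.≤ᵇ lookup α t in eq
  ... | false = sym (QP.*-zeroˡ (hk k α))
  ... | true = trans (hk-shift k (suc i) α t i<k (≤ᵇ⇒≤ eq)) (sym (QP.*-identityˡ (hk k α)))

-- Newton's identity: in ∑_{i<k} ∑_t [i + 1 ≤ a_t], each exponent a_t of x^α is counted a_t times.
newton : ∀ {N} k (α : Vec ℕ N) → fromℕ k * hk k α ≡ ∑ℕ k (λ i → (pk (suc i) · hk (k ∸ suc i)) α)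
newton {N} k α = sym (begin
    ∑ℕ k (λ i → (pk (suc i) · hk (k ∸ suc i)) α)
  ≡⟨ ∑ℕ-cong k (λ i i<k → pk-·-hk k i α i<k) ⟩
    ∑ℕ k (λ i → count i * hk k α)
  ≡⟨ ∑ℕ-cong′ k (λ i → QP.*-comm (count i) (hk k α)) ⟩
    ∑ℕ k (λ i → hk k α * count i)
  ≡⟨ ∑ℕ-*ˡ k (hk k α) count ⟩
    hk k α * ∑ℕ k count
  ≡⟨ counted (V.sum α ℕ.≟ k) ⟩
    fromℕ k * hk k α
  ∎)
  where
  open ≡-Reasoning
  count : ℕ → ℚ
  count i = sum (λ t → 𝟙 (suc i ℕ.≤ᵇ lookup α t))
  counted : Dec (V.sum α ≡ k) → hk k α * ∑ℕ k count ≡ fromℕ k * hk k α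
  counted (no ne) rewrite hk-off-degree k α ne = trans (QP.*-zeroˡ (∑ℕ k count)) (sym (QP.*-zeroʳ (fromℕ k)))
  counted (yes e) rewrite hk-degree k α e = begin
      1ℚ * ∑ℕ k count
    ≡⟨ QP.*-identityˡ (∑ℕ k count) ⟩
      ∑ℕ k count
    ≡⟨ ∑-comm {k} {N} (λ i t → 𝟙 (suc (toℕ i) ℕ.≤ᵇ lookup α t)) ⟩
      sum (λ t → ∑ℕ k (λ i → 𝟙 (suc i ℕ.≤ᵇ lookup α t)))
    ≡⟨ sum-cong-≗ {N} (λ t → ∑ℕ-count k (lookup α t) (subst (lookup α t ℕ.≤_) e (lookup≤sum α t))) ⟩
      sum (λ t → fromℕ (lookup α t))
    ≡⟨ sum-fromℕ α ⟩
      fromℕ (V.sum α)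
    ≡⟨ cong fromℕ e ⟩
      fromℕ k
    ≡⟨ QP.*-identityʳ (fromℕ k) ⟨
      fromℕ k * 1ℚ
    ∎

-- Positively h-alternating functions

0≤* : ∀ {a b} → 0ℚ Q.≤ a → 0ℚ Q.≤ b → 0ℚ Q.≤ a * b
0≤* {a} {b} p q = QP.nonNegative⁻¹ (a * b) {{QP.nonNeg*nonNeg⇒nonNeg a {{Q.nonNegative p}} b {{Q.nonNegative q}}}}

0≤+ : ∀ {a b} → 0ℚ Q.≤ a → 0ℚ Q.≤ b → 0ℚ Q.≤ a + b
0≤+ {a} {b} p q = subst (Q._≤ a + b) (QP.+-identityˡ 0ℚ) (QP.+-mono-≤ p q)

0≤1 : 0ℚ Q.≤ 1ℚ
0≤1 = QP.<⇒≤ (QP.positive⁻¹ 1ℚ)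

0≤fromℕ : ∀ n → 0ℚ Q.≤ fromℕ n
0≤fromℕ zero = QP.≤-refl
0≤fromℕ (suc n) = 0≤+ 0≤1 (0≤fromℕ n)

signedHb : ∀ {N} → ℕ → List ℕ → Poly N
signedHb n μ = sgn (n ∸ length μ) ⊙ hb μ

single : ∀ {N} (b : List ℕ → Poly N) μ α → b μ α ≡ lin b ((μ , 1ℚ) ∷ []) α
single b μ α = unit (b μ α)
  where
  unit : ∀ x → x ≡ 1ℚ * x + 0ℚ
  unit = solve-∀ ℚ-ring

posHAlt-signedHb : ∀ {N n μ} → IsPartition n μ → PosHAlternating {N} n (signedHb n μ)
posHAlt-signedHb {n = n} {μ} μ⊢n = (μ , 1ℚ) ∷ [] , (μ⊢n , 0≤1) ∷ [] , single (signedHb n) μ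

posHAlt-cong : ∀ {N n} {f g : Poly N} → f ≈ g → PosHAlternating n f → PosHAlternating n g
posHAlt-cong e (L , nonneg , f≈) = L , nonneg , ≈-trans (≈-sym e) f≈

posHAlt-0 : ∀ {N n} → PosHAlternating {N} n (λ _ → 0ℚ)
posHAlt-0 = [] , [] , (λ _ → refl)

posHAlt-+ : ∀ {N n} {f g : Poly N} → PosHAlternating n f → PosHAlternating n g →
  PosHAlternating n (λ α → f α + g α)
posHAlt-+ {n = n} (L , nonneg , f≈) (M , nonneg′ , g≈) =
  L ++ M , AllP.++⁺ nonneg nonneg′ , (λ α → trans (cong₂ _+_ (f≈ α) (g≈ α)) (sym (lin-++ (signedHb n) L M α)))

posHAlt-⊙ : ∀ {N n} {f : Poly N} c → 0ℚ Q.≤ c → PosHAlternating n f → PosHAlternating n (c ⊙ f)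
posHAlt-⊙ {n = n} c 0≤c (L , nonneg , f≈) =
  rescale (λ _ → c) L ,
  AllP.map⁺ (All.map (λ (λ⊢n , 0≤d) → λ⊢n , 0≤* 0≤c 0≤d) nonneg) ,
  (λ α → trans (cong (c *_) (f≈ α))
    (sym (trans (lin-rescale (signedHb n) (λ _ → c) L α) (lin-⊙ (signedHb n) c L α))))

posHAlt-lin : ∀ {N n} (b : List ℕ → Poly N) L →
  All (λ x → 0ℚ Q.≤ proj₂ x × PosHAlternating n (b (proj₁ x))) L → PosHAlternating n (lin b L)
posHAlt-lin b [] [] = posHAlt-0
posHAlt-lin b ((μ , c) ∷ L) ((0≤c , p) ∷ ps) = posHAlt-+ (posHAlt-⊙ c 0≤c p) (posHAlt-lin b L ps)

posHAlt-∑ℕ : ∀ {N n} k (F : ℕ → Poly N) → (∀ i → i ℕ.< k → PosHAlternating n (F i)) →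
  PosHAlternating n (λ α → ∑ℕ k (λ i → F i α))
posHAlt-∑ℕ zero F p = posHAlt-0
posHAlt-∑ℕ (suc k) F p = posHAlt-+ (p 0 (s≤s z≤n)) (posHAlt-∑ℕ k (F ∘ suc) (λ i i<k → p (suc i) (s≤s i<k)))

·-identityˡ : ∀ {N} (f : Poly N) → (one · f) ≈ f
·-identityˡ f = ≈-trans (·-comm one f) (·-identityʳ f)

hb-++ : ∀ {N} (μ ν : List ℕ) → hb {N} (μ ++ ν) ≈ (hb μ · hb ν)
hb-++ [] ν = ≈-sym (·-identityˡ (hb ν))
hb-++ (k ∷ μ) ν = ≈-trans (·-congʳ (hk k) (hb-++ μ ν)) (≈-sym (·-assoc (hk k) (hb μ) (hb ν)))

hb-↭ : ∀ {N} {μ ν : List ℕ} → μ Perm.↭ ν → hb {N} μ ≈ hb ν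
hb-↭ Perm.refl α = refl
hb-↭ (Perm.prep x p) = ·-congʳ (hk x) (hb-↭ p)
hb-↭ (Perm.swap {ys = ys} x y p) = ≈-trans (·-congʳ (hk x) (·-congʳ (hk y) (hb-↭ p))) swap
  where
  swap : (hk x · (hk y · hb ys)) ≈ (hk y · (hk x · hb ys))
  swap = ≈-trans (≈-sym (·-assoc (hk x) (hk y) (hb ys)))
    (≈-trans (·-congˡ (hb ys) (·-comm (hk x) (hk y))) (·-assoc (hk y) (hk x) (hb ys)))
hb-↭ (Perm.trans p q) = ≈-trans (hb-↭ p) (hb-↭ q)

length≤sum : ∀ {μ} → All (0 ℕ.<_) μ → length μ ℕ.≤ ℕL.sum μ
length≤sum [] = z≤n
length≤sum (p ∷ ps) = ℕP.+-mono-≤ p (length≤sum ps)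

partition-length≤ : ∀ {n μ} → IsPartition n μ → length μ ℕ.≤ n
partition-length≤ {μ = μ} (pos , _ , Σμ≡n) = subst (length μ ℕ.≤_) Σμ≡n (length≤sum pos)

sgn-+ : ∀ x y → sgn (x ℕ.+ y) ≡ sgn x * sgn y
sgn-+ zero y = sym (QP.*-identityˡ _)
sgn-+ (suc x) y rewrite sgn-+ x y = QP.neg-distribˡ-* (sgn x) (sgn y)

∸-+-distrib : ∀ a b m k → m ℕ.≤ a → k ℕ.≤ b → (a ℕ.+ b) ∸ (m ℕ.+ k) ≡ (a ∸ m) ℕ.+ (b ∸ k)
∸-+-distrib a b m k m≤a k≤b = begin
  (a ℕ.+ b) ∸ (m ℕ.+ k)   ≡⟨ ℕP.∸-+-assoc (a ℕ.+ b) m k ⟨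
  (a ℕ.+ b) ∸ m ∸ k       ≡⟨ cong (_∸ k) (ℕP.+-∸-comm b m≤a) ⟩
  (a ∸ m) ℕ.+ b ∸ k       ≡⟨ ℕP.+-∸-assoc (a ∸ m) k≤b ⟩
  (a ∸ m) ℕ.+ (b ∸ k)     ∎
  where open ≡-Reasoning

merge : List ℕ → List ℕ → List ℕ
merge μ ν = sort (μ ++ ν)

merge-partition : ∀ {a b μ ν} → IsPartition a μ → IsPartition b ν → IsPartition (a ℕ.+ b) (merge μ ν)
merge-partition {μ = μ} {ν} (pos , _ , Σμ) (pos′ , _ , Σν) =
  PermP.All-resp-↭ (Perm.↭-sym (sort-↭ (μ ++ ν))) (AllP.++⁺ pos pos′) ,
  sort-↗ (μ ++ ν) ,
  trans (ℕLP.sum-↭ (sort-↭ (μ ++ ν))) (trans (ℕLP.sum-++ μ ν) (cong₂ ℕ._+_ Σμ Σν))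

signedHb-· : ∀ {N a b μ ν} → IsPartition a μ → IsPartition b ν →
  (signedHb a μ · signedHb b ν) ≈ signedHb {N} (a ℕ.+ b) (merge μ ν)
signedHb-· {N} {a} {b} {μ} {ν} μ⊢a ν⊢b α = begin
    (signedHb a μ · signedHb b ν) α
  ≡⟨ ⊙-·ˡ (sgn (a ∸ length μ)) (hb μ) (signedHb b ν) α ⟩
    sgn (a ∸ length μ) * (hb μ · signedHb b ν) α
  ≡⟨ cong (sgn (a ∸ length μ) *_) (⊙-·ʳ (sgn (b ∸ length ν)) (hb μ) (hb ν) α) ⟩
    sgn (a ∸ length μ) * (sgn (b ∸ length ν) * (hb μ · hb ν) α)
  ≡⟨ QP.*-assoc (sgn (a ∸ length μ)) (sgn (b ∸ length ν)) ((hb μ · hb ν) α) ⟨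
    (sgn (a ∸ length μ) * sgn (b ∸ length ν)) * (hb μ · hb ν) α
  ≡⟨ cong₂ _*_ signs (≈-sym (≈-trans (hb-↭ (sort-↭ (μ ++ ν))) (hb-++ μ ν)) α) ⟩
    signedHb (a ℕ.+ b) (merge μ ν) α
  ∎
  where
  open ≡-Reasoning
  signs : sgn (a ∸ length μ) * sgn (b ∸ length ν) ≡ sgn ((a ℕ.+ b) ∸ length (merge μ ν))
  signs = sym (begin
      sgn ((a ℕ.+ b) ∸ length (merge μ ν))
    ≡⟨ cong (λ l → sgn ((a ℕ.+ b) ∸ l)) (trans (PermP.↭-length (sort-↭ (μ ++ ν))) (LP.length-++ μ)) ⟩
      sgn ((a ℕ.+ b) ∸ (length μ ℕ.+ length ν))
    ≡⟨ cong sgn (∸-+-distrib a b (length μ) (length ν) (partition-length≤ μ⊢a) (partition-length≤ ν⊢b)) ⟩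
      sgn ((a ∸ length μ) ℕ.+ (b ∸ length ν))
    ≡⟨ sgn-+ (a ∸ length μ) (b ∸ length ν) ⟩
      sgn (a ∸ length μ) * sgn (b ∸ length ν)
    ∎)

posHAlt-· : ∀ {N a b} {f g : Poly N} → PosHAlternating a f → PosHAlternating b g →
  PosHAlternating (a ℕ.+ b) (f · g)
posHAlt-· {N} {a} {b} {f} {g} (L , nonneg , f≈) (M , nonneg′ , g≈) =
  posHAlt-cong (≈-sym (≈-trans (·-congˡ g f≈) (lin-·ˡ (signedHb a) L g)))
    (posHAlt-lin (λ μ → signedHb a μ · g) L (All.map (λ (μ⊢a , 0≤c) → 0≤c , posHAlt-signedHb-· μ⊢a) nonneg))
  where
  posHAlt-signedHb-· : ∀ {μ} → IsPartition a μ → PosHAlternating (a ℕ.+ b) (signedHb a μ · g)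
  posHAlt-signedHb-· {μ} μ⊢a =
    posHAlt-cong (≈-sym (≈-trans (·-congʳ (signedHb a μ) g≈) (lin-·ʳ (signedHb b) M (signedHb a μ))))
      (posHAlt-lin (λ ν → signedHb a μ · signedHb b ν) M
        (All.map (λ (ν⊢b , 0≤d) → 0≤d ,
          posHAlt-cong (≈-sym (signedHb-· μ⊢a ν⊢b)) (posHAlt-signedHb (merge-partition μ⊢a ν⊢b))) nonneg′))

hk-0 : ∀ {N} → hk {N} 0 ≈ one
hk-0 [] = refl
hk-0 (zero ∷ α) = hk-0 α
hk-0 (suc a ∷ α) = refl

posHAlt-hk : ∀ {N} k → 0 ℕ.< k → PosHAlternating {N} k (sgn (k ∸ 1) ⊙ hk k)
posHAlt-hk k 0<k = posHAlt-cong (λ α → cong (sgn (k ∸ 1) *_) (·-identityʳ (hk k) α))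
  (posHAlt-signedHb ((0<k ∷ []) , [-] , ℕP.+-identityʳ k))

ωpk : ∀ {N} → ℕ → Poly N
ωpk k = sgn (k ∸ 1) ⊙ pk k

sgn-split : ∀ i m → i ℕ.< m → sgn i * sgn (m ∸ suc i) ≡ - sgn m
sgn-split i m i<m = begin
    sgn i * sgn (m ∸ suc i)
  ≡⟨ negate (sgn i) (sgn (m ∸ suc i)) ⟩
    - (sgn i * sgn (suc (m ∸ suc i)))
  ≡⟨ cong -_ (sgn-+ i (suc (m ∸ suc i))) ⟨
    - sgn (i ℕ.+ suc (m ∸ suc i))
  ≡⟨ cong (λ z → - sgn z) (trans (ℕP.+-suc i (m ∸ suc i)) (ℕP.m+[n∸m]≡n i<m)) ⟩
    - sgn m
  ∎
  where
  open ≡-Reasoning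
  negate : ∀ x y → x * y ≡ - (x * (- y))
  negate = solve-∀ ℚ-ring

-- Newton's identity multiplied by (-1)^m, with p_{m+1} isolated.
ωpk-recurrence : ∀ {N} m (α : Vec ℕ N) →
  ωpk (suc m) α ≡ fromℕ (suc m) * (sgn m * hk (suc m) α) +
                  ∑ℕ m (λ i → (ωpk (suc i) · (sgn (m ∸ suc i) ⊙ hk (m ∸ i))) α)
ωpk-recurrence m α = begin
    sgn m * P
  ≡⟨ isolate (sgn m) S P ⟩
    sgn m * (S + P) + (- sgn m) * S
  ≡⟨ cong (λ z → sgn m * z + (- sgn m) * S) newton-split ⟨
    sgn m * (fromℕ (suc m) * H) + (- sgn m) * S
  ≡⟨ cong₂ _+_ (exchange (sgn m) (fromℕ (suc m)) H)
               (sym (trans (∑ℕ-cong m term) (∑ℕ-*ˡ m (- sgn m) Tᵢ))) ⟩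
    fromℕ (suc m) * (sgn m * H) + ∑ℕ m (λ i → (ωpk (suc i) · (sgn (m ∸ suc i) ⊙ hk (m ∸ i))) α)
  ∎
  where
  open ≡-Reasoning
  P = pk (suc m) α
  H = hk (suc m) α
  Tᵢ : ℕ → ℚ
  Tᵢ i = (pk (suc i) · hk (m ∸ i)) α
  S = ∑ℕ m Tᵢ
  newton-split : fromℕ (suc m) * H ≡ S + P
  newton-split = trans (newton (suc m) α) (trans (∑ℕ-last m Tᵢ) (cong (S +_)
    (trans (cong (λ j → (pk (suc m) · hk j) α) (ℕP.n∸n≡0 m))
           (trans (·-congʳ (pk (suc m)) hk-0 α) (·-identityʳ (pk (suc m)) α)))))
  term : ∀ i → i ℕ.< m → (ωpk (suc i) · (sgn (m ∸ suc i) ⊙ hk (m ∸ i))) α ≡ (- sgn m) * Tᵢ i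
  term i i<m = begin
      (ωpk (suc i) · (sgn (m ∸ suc i) ⊙ hk (m ∸ i))) α
    ≡⟨ ⊙-·ˡ (sgn i) (pk (suc i)) (sgn (m ∸ suc i) ⊙ hk (m ∸ i)) α ⟩
      sgn i * (pk (suc i) · (sgn (m ∸ suc i) ⊙ hk (m ∸ i))) α
    ≡⟨ cong (sgn i *_) (⊙-·ʳ (sgn (m ∸ suc i)) (pk (suc i)) (hk (m ∸ i)) α) ⟩
      sgn i * (sgn (m ∸ suc i) * Tᵢ i)
    ≡⟨ QP.*-assoc (sgn i) (sgn (m ∸ suc i)) (Tᵢ i) ⟨
      (sgn i * sgn (m ∸ suc i)) * Tᵢ i
    ≡⟨ cong (_* Tᵢ i) (sgn-split i m i<m) ⟩
      (- sgn m) * Tᵢ i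
    ∎
  exchange : ∀ s q h → s * (q * h) ≡ q * (s * h)
  exchange = solve-∀ ℚ-ring
  isolate : ∀ s S P → s * P ≡ s * (S + P) + (- s) * S
  isolate = solve-∀ ℚ-ring

posHAlt-ωpk : ∀ {N} m → PosHAlternating {N} (suc m) (ωpk (suc m))
posHAlt-ωpk {N} = <-rec (λ m → PosHAlternating {N} (suc m) (ωpk (suc m))) step
  where
  step : ∀ m → (∀ {i} → i ℕ.< m → PosHAlternating (suc i) (ωpk (suc i))) →
         PosHAlternating (suc m) (ωpk (suc m))
  step m IH = posHAlt-cong (≈-sym (ωpk-recurrence m))
    (posHAlt-+ (posHAlt-⊙ (fromℕ (suc m)) (0≤fromℕ (suc m)) (posHAlt-hk (suc m) (s≤s z≤n)))
               (posHAlt-∑ℕ m term posHAlt-term))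
    where
    term : ℕ → Poly N
    term i = ωpk (suc i) · (sgn (m ∸ suc i) ⊙ hk (m ∸ i))
    posHAlt-hk′ : ∀ i → i ℕ.< m → PosHAlternating (m ∸ i) (sgn (m ∸ suc i) ⊙ hk (m ∸ i))
    posHAlt-hk′ i i<m = subst (λ e → PosHAlternating {N} (m ∸ i) (sgn e ⊙ hk (m ∸ i)))
      (trans (ℕP.∸-+-assoc m i 1) (cong (m ∸_) (ℕP.+-comm i 1))) (posHAlt-hk (m ∸ i) (ℕP.m<n⇒0<n∸m i<m))
    posHAlt-term : ∀ i → i ℕ.< m → PosHAlternating (suc m) (term i)
    posHAlt-term i i<m = subst (λ d → PosHAlternating d (term i)) (cong suc (ℕP.m+[n∸m]≡n (ℕP.<⇒≤ i<m)))
      (posHAlt-· (IH i<m) (posHAlt-hk′ i i<m))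

ωpk-·-ωpb : ∀ {N} k μ → (ωpk (suc k) · (ωsign μ ⊙ pb μ)) ≈ (ωsign (suc k ∷ μ) ⊙ pb {N} (suc k ∷ μ))
ωpk-·-ωpb k μ α = begin
    (ωpk (suc k) · (ωsign μ ⊙ pb μ)) α
  ≡⟨ ⊙-·ˡ (sgn k) (pk (suc k)) (ωsign μ ⊙ pb μ) α ⟩
    sgn k * (pk (suc k) · (ωsign μ ⊙ pb μ)) α
  ≡⟨ cong (sgn k *_) (⊙-·ʳ (ωsign μ) (pk (suc k)) (pb μ) α) ⟩
    sgn k * (ωsign μ * pb (suc k ∷ μ) α)
  ≡⟨ QP.*-assoc (sgn k) (ωsign μ) _ ⟨
    (ωsign (suc k ∷ μ) ⊙ pb (suc k ∷ μ)) α
  ∎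
  where open ≡-Reasoning

posHAlt-ωpb : ∀ {N n μ} → IsPartition n μ → PosHAlternating {N} n (ωsign μ ⊙ pb μ)
posHAlt-ωpb {μ = []} μ⊢n@(_ , _ , refl) = posHAlt-signedHb μ⊢n
posHAlt-ωpb {μ = suc k ∷ μ} (_ ∷ pos , sorted , refl) = posHAlt-cong (ωpk-·-ωpb k μ)
  (posHAlt-· (posHAlt-ωpk k) (posHAlt-ωpb (pos , Linked.tail sorted , refl)))

-- Linear independence of the power sums

0≤sum : ∀ {N} (φ : Fin N → ℚ) → (∀ t → 0ℚ Q.≤ φ t) → 0ℚ Q.≤ sum φ
0≤sum {zero} φ p = QP.≤-refl
0≤sum {suc N} φ p = 0≤+ (p zero) (0≤sum (φ ∘ suc) (p ∘ suc))

sum≢0 : ∀ {N} (φ : Fin N → ℚ) → sum φ ≢ 0ℚ → Σ (Fin N) (λ t → φ t ≢ 0ℚ)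
sum≢0 {zero} φ ne = ⊥-elim (ne refl)
sum≢0 {suc N} φ ne with φ zero Q.≟ 0ℚ
... | no φ₀≢0 = zero , φ₀≢0
... | yes φ₀≡0 with sum≢0 (φ ∘ suc) (λ e → ne (cong₂ _+_ φ₀≡0 e))
...   | t , φₜ≢0 = suc t , φₜ≢0

0<+ : ∀ {a b} → 0ℚ Q.< a → 0ℚ Q.≤ b → 0ℚ Q.< a + b
0<+ {a} {b} p q = subst (Q._< a + b) (QP.+-identityˡ 0ℚ) (QP.+-mono-<-≤ p q)

*-cancelʳ-0 : ∀ {c x} → c * x ≡ 0ℚ → 0ℚ Q.< x → c ≡ 0ℚ
*-cancelʳ-0 {c} {x} e p with QP.<-cmp c 0ℚ
... | tri≈ _ c≡0 _ = c≡0
... | tri< c<0 _ _ = ⊥-elim (QP.<-irrefl e (subst (c * x Q.<_) (QP.*-zeroˡ x)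
        (QP.*-monoˡ-<-pos x {{Q.positive p}} c<0)))
... | tri> _ _ c>0 = ⊥-elim (QP.<-irrefl (sym e) (subst (Q._< c * x) (QP.*-zeroˡ x)
        (QP.*-monoˡ-<-pos x {{Q.positive p}} c>0)))

0≤if : ∀ b {x} → 0ℚ Q.≤ x → 0ℚ Q.≤ (if b then x else 0ℚ)
0≤if true p = p
0≤if false p = QP.≤-refl

nonzeros : ∀ {N} → Vec ℕ N → List ℕ
nonzeros [] = []
nonzeros (zero ∷ α) = nonzeros α
nonzeros (suc a ∷ α) = suc a ∷ nonzeros α

nonzeros-positive : ∀ {N} (α : Vec ℕ N) → All (0 ℕ.<_) (nonzeros α)
nonzeros-positive [] = []
nonzeros-positive (zero ∷ α) = nonzeros-positive α
nonzeros-positive (suc a ∷ α) = s≤s z≤n ∷ nonzeros-positive α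

nonzeros-replicate : ∀ N → nonzeros (V.replicate N 0) ≡ []
nonzeros-replicate zero = refl
nonzeros-replicate (suc N) = nonzeros-replicate N

pad : ∀ N → List ℕ → Vec ℕ N
pad zero _ = []
pad (suc N) [] = 0 ∷ pad N []
pad (suc N) (x ∷ xs) = x ∷ pad N xs

nonzeros-pad : ∀ N μ → All (0 ℕ.<_) μ → length μ ℕ.≤ N → nonzeros (pad N μ) ≡ μ
nonzeros-pad zero [] _ _ = refl
nonzeros-pad (suc N) [] _ _ = nonzeros-pad N [] [] z≤n
nonzeros-pad (suc N) (suc x ∷ xs) (_ ∷ pos) (s≤s ℓ≤N) = cong (suc x ∷_) (nonzeros-pad N xs pos ℓ≤N)

nonzeros-pad-partition : ∀ {n μ} → IsPartition n μ → nonzeros (pad n μ) ≡ μ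
nonzeros-pad-partition {n} {μ} μ⊢n@(pos , _ , _) = nonzeros-pad n μ pos (partition-length≤ μ⊢n)

nonzeros-∸xpow-< : ∀ {N} (α : Vec ℕ N) t k → k ℕ.< lookup α t →
  length (nonzeros (α ∸v xpow t k)) ≡ length (nonzeros α)
nonzeros-∸xpow-< (suc a ∷ α) zero k k<a rewrite ∸v-zeros α with suc a ∸ k | ℕP.m<n⇒0<n∸m k<a
... | suc _ | _ = refl
nonzeros-∸xpow-< (zero ∷ α) (suc t) k k<α = nonzeros-∸xpow-< α t k k<α
nonzeros-∸xpow-< (suc a ∷ α) (suc t) k k<α = cong suc (nonzeros-∸xpow-< α t k k<α)

nonzeros-∸xpow-≡ : ∀ {N} (α : Vec ℕ N) t k → 0 ℕ.< k → k ≡ lookup α t →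
  nonzeros α Perm.↭ (k ∷ nonzeros (α ∸v xpow t k))
nonzeros-∸xpow-≡ (suc a ∷ α) zero .(suc a) _ refl rewrite ∸v-zeros α | ℕP.n∸n≡0 a = Perm.refl
nonzeros-∸xpow-≡ (zero ∷ α) zero .zero () refl
nonzeros-∸xpow-≡ (zero ∷ α) (suc t) k 0<k k≡α = nonzeros-∸xpow-≡ α t k 0<k k≡α
nonzeros-∸xpow-≡ (suc a ∷ α) (suc t) k 0<k k≡α =
  Perm.trans (Perm.prep (suc a) (nonzeros-∸xpow-≡ α t k 0<k k≡α)) (Perm.swap (suc a) k Perm.refl)

nonzeros-∸xpow : ∀ {N} (α : Vec ℕ N) t k → 0 ℕ.< k → k ℕ.≤ lookup α t →
  length (nonzeros α) ℕ.≤ suc (length (nonzeros (α ∸v xpow t k)))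
nonzeros-∸xpow α t k 0<k k≤α with ℕP.m≤n⇒m<n∨m≡n k≤α
... | inj₁ k<α = ℕP.≤-trans (ℕP.≤-reflexive (sym (nonzeros-∸xpow-< α t k k<α))) (ℕP.n≤1+n _)
... | inj₂ k≡α = ℕP.≤-reflexive (PermP.↭-length (nonzeros-∸xpow-≡ α t k 0<k k≡α))

one≢0 : ∀ {N} (α : Vec ℕ N) → one α ≢ 0ℚ → α ≡ V.replicate N 0
one≢0 {N} α ne with VP.≡-dec ℕ._≟_ α (V.replicate N 0)
... | yes e = e
... | no _ = ⊥-elim (ne refl)

0≤one : ∀ {N} (α : Vec ℕ N) → 0ℚ Q.≤ one α
0≤one {N} α with VP.≡-dec ℕ._≟_ α (V.replicate N 0)
... | yes _ = 0≤1
... | no _ = QP.≤-refl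

0≤pb : ∀ {N} μ (α : Vec ℕ N) → 0ℚ Q.≤ pb μ α
0≤pb [] α = 0≤one α
0≤pb (k ∷ μ) α = subst (0ℚ Q.≤_) (sym (pk-· k (pb μ) α))
  (0≤sum _ (λ t → 0≤if (xpow t k ≤ᵛᵇ α) (0≤pb μ (α ∸v xpow t k))))

pb≢0-cons : ∀ {N} k μ (α : Vec ℕ N) → pb (k ∷ μ) α ≢ 0ℚ →
  Σ (Fin N) (λ t → (k ℕ.≤ lookup α t) × pb μ (α ∸v xpow t k) ≢ 0ℚ)
pb≢0-cons k μ α ne with sum≢0 _ (λ e → ne (trans (pk-· k (pb μ) α) e))
... | t , termₜ≢0 = t , split termₜ≢0
  where
  split : (if xpow t k ≤ᵛᵇ α then pb μ (α ∸v xpow t k) else 0ℚ) ≢ 0ℚ →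
          (k ℕ.≤ lookup α t) × pb μ (α ∸v xpow t k) ≢ 0ℚ
  split ne′ rewrite xpow-≤ᵛᵇ t k α with k ℕ.≤ᵇ lookup α t in eq
  ... | true = ≤ᵇ⇒≤ eq , ne′
  ... | false = ⊥-elim (ne′ refl)

-- Each factor p_k of p_μ accounts for at most one nonzero exponent of a monomial of p_μ.
pb≢0⇒length≤ : ∀ {N} μ (α : Vec ℕ N) → All (0 ℕ.<_) μ → pb μ α ≢ 0ℚ →
  length (nonzeros α) ℕ.≤ length μ
pb≢0⇒length≤ {N} [] α _ ne rewrite one≢0 α ne | nonzeros-replicate N = z≤n
pb≢0⇒length≤ (k ∷ μ) α (0<k ∷ pos) ne with pb≢0-cons k μ α ne
... | t , k≤α , ne′ = ℕP.≤-trans (nonzeros-∸xpow α t k 0<k k≤α) (s≤s (pb≢0⇒length≤ μ _ pos ne′))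

pb≢0⇒↭ : ∀ {N} μ (α : Vec ℕ N) → All (0 ℕ.<_) μ → pb μ α ≢ 0ℚ →
  length μ ≡ length (nonzeros α) → μ Perm.↭ nonzeros α
pb≢0⇒↭ [] α _ ne ℓ≡ with nonzeros α
... | [] = Perm.refl
pb≢0⇒↭ (k ∷ μ) α (0<k ∷ pos) ne ℓ≡ with pb≢0-cons k μ α ne
... | t , k≤α , ne′ with ℕP.m≤n⇒m<n∨m≡n k≤α
...   | inj₁ k<α = ⊥-elim (ℕP.<-irrefl refl (ℕP.≤-trans
          (s≤s (ℕP.≤-reflexive (trans ℓ≡ (sym (nonzeros-∸xpow-< α t k k<α)))))
          (s≤s (pb≢0⇒length≤ μ _ pos ne′))))
...   | inj₂ k≡α = Perm.trans
          (Perm.prep k (pb≢0⇒↭ μ _ pos ne′ (ℕP.suc-injective (trans ℓ≡ (PermP.↭-length perm)))))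
          (Perm.↭-sym perm)
  where
  perm = nonzeros-∸xpow-≡ α t k 0<k k≡α

pb-cons-0 : ∀ {N} μ (β : Vec ℕ N) → All (0 ℕ.<_) μ → pb μ (0 ∷ β) ≡ pb μ β
pb-cons-0 [] β _ = refl
pb-cons-0 {N} (suc k ∷ μ) β (_ ∷ pos) = begin
    pb (suc k ∷ μ) (0 ∷ β)
  ≡⟨ pk-· (suc k) (pb μ) (0 ∷ β) ⟩
    0ℚ + sum (λ t → if xpow t (suc k) ≤ᵛᵇ β then pb μ (0 ∷ (β ∸v xpow t (suc k))) else 0ℚ)
  ≡⟨ QP.+-identityˡ _ ⟩
    sum (λ t → if xpow t (suc k) ≤ᵛᵇ β then pb μ (0 ∷ (β ∸v xpow t (suc k))) else 0ℚ)
  ≡⟨ sum-cong-≗ {N} (λ t → cong (λ z → if xpow t (suc k) ≤ᵛᵇ β then z else 0ℚ) (pb-cons-0 μ _ pos)) ⟩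
    sum (λ t → if xpow t (suc k) ≤ᵛᵇ β then pb μ (β ∸v xpow t (suc k)) else 0ℚ)
  ≡⟨ pk-· (suc k) (pb μ) β ⟨
    pb (suc k ∷ μ) β
  ∎
  where open ≡-Reasoning

0<pb-nonzeros : ∀ {N} (α : Vec ℕ N) → 0ℚ Q.< pb (nonzeros α) α
0<pb-nonzeros [] = QP.positive⁻¹ 1ℚ
0<pb-nonzeros (zero ∷ α) =
  subst (0ℚ Q.<_) (sym (pb-cons-0 (nonzeros α) α (nonzeros-positive α))) (0<pb-nonzeros α)
0<pb-nonzeros {suc N} (suc a ∷ α) = subst (0ℚ Q.<_) (sym (pk-· (suc a) (pb (nonzeros α)) (suc a ∷ α)))
  (0<+ first (0≤sum {N} _ (λ t → 0≤if (xpow (suc t) (suc a) ≤ᵛᵇ (suc a ∷ α)) (0≤pb (nonzeros α) _))))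
  where
  first : 0ℚ Q.< (if xpow zero (suc a) ≤ᵛᵇ (suc a ∷ α)
                  then pb (nonzeros α) ((suc a ∷ α) ∸v xpow zero (suc a)) else 0ℚ)
  first rewrite zeros-≤ᵛᵇ α | Equivalence.to T-≡ (ℕP.<⇒<ᵇ (ℕP.n<1+n a)) | ∸v-zeros α | ℕP.n∸n≡0 a =
    subst (0ℚ Q.<_) (sym (pb-cons-0 (nonzeros α) α (nonzeros-positive α))) (0<pb-nonzeros α)

sorted-↭⇒≡ : ∀ {μ ν : List ℕ} → Linked ℕ._≥_ μ → Linked ℕ._≥_ ν → μ Perm.↭ ν → μ ≡ ν
sorted-↭⇒≡ sorted sorted′ μ↭ν = Pointwise-≡⇒≡ (SortedP.↗↭↗⇒≋ ≥.≥-totalOrder sorted sorted′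
  (Perm.↭⇒↭ₛ′ (TotalOrder.Eq.isEquivalence ≥.≥-totalOrder) μ↭ν))

pb-pad-vanishes : ∀ {n μ κ} → IsPartition n μ → IsPartition n κ → length μ ℕ.≤ length κ → μ ≢ κ →
  pb {n} μ (pad n κ) ≡ 0ℚ
pb-pad-vanishes {n} {μ} {κ} μ⊢n@(pos , sorted , _) κ⊢n@(_ , sorted′ , _) ℓμ≤ℓκ μ≢κ
  with pb {n} μ (pad n κ) Q.≟ 0ℚ
... | yes pbμ≡0 = pbμ≡0
... | no pbμ≢0 = ⊥-elim (μ≢κ (sorted-↭⇒≡ sorted sorted′ μ↭κ))
  where
  nonzeros≡κ = nonzeros-pad-partition κ⊢n
  ℓκ≤ℓμ : length κ ℕ.≤ length μ
  ℓκ≤ℓμ = subst (λ ν → length ν ℕ.≤ length μ) nonzeros≡κ (pb≢0⇒length≤ μ (pad n κ) pos pbμ≢0)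
  μ↭κ : μ Perm.↭ κ
  μ↭κ = subst (μ Perm.↭_) nonzeros≡κ
    (pb≢0⇒↭ μ (pad n κ) pos pbμ≢0 (trans (ℕP.≤-antisym ℓμ≤ℓκ ℓκ≤ℓμ) (cong length (sym nonzeros≡κ))))

0<pb-pad : ∀ {n κ} → IsPartition n κ → 0ℚ Q.< pb {n} κ (pad n κ)
0<pb-pad {n} {κ} κ⊢n =
  subst (λ ν → 0ℚ Q.< pb ν (pad n κ)) (nonzeros-pad-partition κ⊢n) (0<pb-nonzeros (pad n κ))

_≟ₚ_ : (μ ν : List ℕ) → Dec (μ ≡ ν)
_≟ₚ_ = LP.≡-dec ℕ._≟_

coefficient : List ℕ → Coeffs → ℚ
coefficient κ M = sumOver proj₂ (L.filter (λ x → proj₁ x ≟ₚ κ) M)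

notAt? : (κ : List ℕ) (x : List ℕ × ℚ) → Dec (proj₁ x ≢ κ)
notAt? κ x = ¬? (proj₁ x ≟ₚ κ)

without : List ℕ → Coeffs → Coeffs
without κ = L.filter (notAt? κ)

lin-split : ∀ {N} (b : List ℕ → Poly N) κ M α →
  lin b M α ≡ coefficient κ M * b κ α + lin b (without κ M) α
lin-split b κ [] α = sym (trans (QP.+-identityʳ _) (QP.*-zeroˡ (b κ α)))
lin-split b κ ((μ , c) ∷ M) α with μ ≟ₚ κ
... | yes refl = trans (cong (c * b μ α +_) (lin-split b μ M α)) (collect c (b μ α) (coefficient μ M) _)
  where
  collect : ∀ c x s r → c * x + (s * x + r) ≡ (c + s) * x + r
  collect = solve-∀ ℚ-ring
... | no _ = trans (cong (c * b μ α +_) (lin-split b κ M α)) (swap (c * b μ α) (coefficient κ M * b κ α) _)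
  where
  swap : ∀ a x r → a + (x + r) ≡ x + (a + r)
  swap = solve-∀ ℚ-ring

lin-zero : ∀ {N} (b : List ℕ → Poly N) M α → All (λ x → b (proj₁ x) α ≡ 0ℚ) M → lin b M α ≡ 0ℚ
lin-zero b [] α [] = refl
lin-zero b ((μ , c) ∷ M) α (b≡0 ∷ bs≡0) rewrite b≡0 | lin-zero b M α bs≡0 =
  trans (QP.+-identityʳ _) (QP.*-zeroʳ c)

coefficient-longest : ∀ {n κ} M → IsPartition n κ → All (λ x → IsPartition n (proj₁ x)) M →
  All (λ x → length (proj₁ x) ℕ.≤ length κ) M → lin (pb {n}) M ≈ (λ _ → 0ℚ) → coefficient κ M ≡ 0ℚ
coefficient-longest {n} {κ} M κ⊢n M⊢n M≤κ lin≈0 = *-cancelʳ-0 evaluated (0<pb-pad κ⊢n)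
  where
  others : lin pb (without κ M) (pad n κ) ≡ 0ℚ
  others = lin-zero pb (without κ M) (pad n κ)
    (All.zipWith (λ ((μ⊢n , μ≤κ) , μ≢κ) → pb-pad-vanishes μ⊢n κ⊢n μ≤κ μ≢κ)
      (All.zip (AllP.filter⁺ (notAt? κ) M⊢n , AllP.filter⁺ (notAt? κ) M≤κ) , AllP.all-filter (notAt? κ) M))
  evaluated : coefficient κ M * pb κ (pad n κ) ≡ 0ℚ
  evaluated = begin
      coefficient κ M * pb κ (pad n κ)
    ≡⟨ QP.+-identityʳ _ ⟨
      coefficient κ M * pb κ (pad n κ) + 0ℚ
    ≡⟨ cong (coefficient κ M * pb κ (pad n κ) +_) others ⟨
      coefficient κ M * pb κ (pad n κ) + lin pb (without κ M) (pad n κ)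
    ≡⟨ lin-split pb κ M (pad n κ) ⟨
      lin pb M (pad n κ)
    ≡⟨ lin≈0 (pad n κ) ⟩
      0ℚ
    ∎
    where open ≡-Reasoning

lin-without : ∀ {N} (b : List ℕ → Poly N) κ M → coefficient κ M ≡ 0ℚ → lin b M ≈ lin b (without κ M)
lin-without b κ M c≡0 α = begin
    lin b M α
  ≡⟨ lin-split b κ M α ⟩
    coefficient κ M * b κ α + lin b (without κ M) α
  ≡⟨ cong (λ c → c * b κ α + lin b (without κ M) α) c≡0 ⟩
    0ℚ * b κ α + lin b (without κ M) α
  ≡⟨ cong (_+ lin b (without κ M) α) (QP.*-zeroˡ (b κ α)) ⟩
    0ℚ + lin b (without κ M) α
  ≡⟨ QP.+-identityˡ _ ⟩
    lin b (without κ M) α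
  ∎
  where open ≡-Reasoning

-- Linear independence of the p_λ, λ ⊢ n, for combinations in which a partition may repeat.
pb-independent : ∀ n M → All (λ x → IsPartition n (proj₁ x)) M → lin (pb {n}) M ≈ (λ _ → 0ℚ) →
  ∀ {N} (b : List ℕ → Poly N) → lin b M ≈ (λ _ → 0ℚ)
pb-independent n M M⊢n lin≈0 b = go (length M) M ℕP.≤-refl M⊢n lin≈0
  where
  go : ∀ k M → length M ℕ.≤ k → All (λ x → IsPartition n (proj₁ x)) M →
       lin (pb {n}) M ≈ (λ _ → 0ℚ) → lin b M ≈ (λ _ → 0ℚ)
  go k [] _ _ _ α = refl
  go (suc k) (x ∷ M) (s≤s ℓ≤k) xM⊢n lin≈0 = ≈-trans (lin-without b κ (x ∷ M) c≡0)
      (go k (without κ (x ∷ M)) shorter (AllP.filter⁺ (notAt? κ) xM⊢n)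
        (≈-trans (≈-sym (lin-without pb κ (x ∷ M) c≡0)) lin≈0))
    where
    longest = argmax (length ∘ proj₁) x M
    κ = proj₁ longest
    κ⊢n : IsPartition n κ
    κ⊢n = argmax-all (length ∘ proj₁) {P = λ y → IsPartition n (proj₁ y)} (All.head xM⊢n) (All.tail xM⊢n)
    c≡0 : coefficient κ (x ∷ M) ≡ 0ℚ
    c≡0 = coefficient-longest (x ∷ M) κ⊢n xM⊢n
      (f[⊥]≤f[argmax] {f = length ∘ proj₁} x M ∷ f[xs]≤f[argmax] {f = length ∘ proj₁} x M) lin≈0
    occurs : Any (λ y → ¬ (proj₁ y ≢ κ)) (x ∷ M)
    occurs with argmax-sel (length ∘ proj₁) x M
    ... | inj₁ longest≡x = here (λ ne → ne (cong proj₁ (sym longest≡x)))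
    ... | inj₂ longest∈M = there (Any.map (λ longest≡y ne → ne (cong proj₁ (sym longest≡y))) longest∈M)
    shorter : length (without κ (x ∷ M)) ℕ.≤ k
    shorter = ℕP.≤-trans (ℕP.≤-pred (LP.filter-notAll (notAt? κ) (x ∷ M) occurs)) ℓ≤k

sgn² : ∀ k → sgn k * sgn k ≡ 1ℚ
sgn² zero = refl
sgn² (suc k) = trans (neg² (sgn k)) (sgn² k)
  where
  neg² : ∀ x → (- x) * (- x) ≡ x * x
  neg² = solve-∀ ℚ-ring

ωsign-involutive : ∀ {N} μ (h : Poly N) → (ωsign μ ⊙ (ωsign μ ⊙ h)) ≈ h
ωsign-involutive μ h α = trans (sym (QP.*-assoc (ωsign μ) (ωsign μ) (h α)))
  (trans (cong (_* h α) (ωsign² μ)) (QP.*-identityˡ (h α)))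
  where
  ωsign² : ∀ μ → ωsign μ * ωsign μ ≡ 1ℚ
  ωsign² [] = refl
  ωsign² (k ∷ μ) = trans (exchange (sgn (k ∸ 1)) (ωsign μ)) (cong₂ _*_ (sgn² (k ∸ 1)) (ωsign² μ))
    where
    exchange : ∀ a b → (a * b) * (a * b) ≡ (a * a) * (b * b)
    exchange = solve-∀ ℚ-ring

negate : Coeffs → Coeffs
negate = rescale (λ _ → - 1ℚ)

lin-++-negate : ∀ {N} (b : List ℕ → Poly N) L M α → lin b (L ++ negate M) α ≡ lin b L α Q.- lin b M α
lin-++-negate b L M α = trans (lin-++ b L (negate M) α)
  (cong (lin b L α +_) (trans (lin-rescale b (λ _ → - 1ℚ) M α)
    (trans (lin-⊙ b (- 1ℚ) M α) (neg-one (lin b M α)))))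
  where
  neg-one : ∀ x → (- 1ℚ) * x ≡ - x
  neg-one = solve-∀ ℚ-ring

pb-expansion-unique : ∀ {n} L M → All (λ x → IsPartition n (proj₁ x)) L → All (λ x → IsPartition n (proj₁ x)) M →
  lin (pb {n}) L ≈ lin pb M → ∀ {N} (b : List ℕ → Poly N) → lin b L ≈ lin b M
pb-expansion-unique {n} L M L⊢n M⊢n L≈M b α = x∙y⁻¹≈ε⇒x≈y (lin b L α) (lin b M α)
  (trans (sym (lin-++-negate b L M α)) (pb-independent n (L ++ negate M) L-M⊢n L-M≈0 b α))
  where
  L-M⊢n : All (λ x → IsPartition n (proj₁ x)) (L ++ negate M)
  L-M⊢n = AllP.++⁺ L⊢n (AllP.map⁺ M⊢n)
  L-M≈0 : lin pb (L ++ negate M) ≈ (λ _ → 0ℚ)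
  L-M≈0 α = trans (lin-++-negate pb L M α) (trans (cong (Q._- lin pb M α) (L≈M α)) (QP.+-inverseʳ (lin pb M α)))

lemma1p14 : (n : ℕ) (f : Poly n) → Symmetric f → Homogeneous n f →
    (∃ λ g → IsOmega n f g × PPositive n g) → PosHAlternating n f
lemma1p14 n f _ _ (g , (L , L⊢n , f≈ , g≈) , (L′ , L′⊢n⁺ , g≈′)) =
  posHAlt-cong f-expansion (posHAlt-lin ωpb L′ (All.map (λ (μ⊢n , 0≤c) → 0≤c , posHAlt-ωpb μ⊢n) L′⊢n⁺))
  where
  ωpb : List ℕ → Poly n
  ωpb μ = ωsign μ ⊙ pb μ
  f-expansion : lin ωpb L′ ≈ f
  f-expansion α = begin
      lin ωpb L′ α
    ≡⟨ pb-expansion-unique (rescale ωsign L) L′ (AllP.map⁺ L⊢n) (All.map proj₁ L′⊢n⁺)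
         (≈-trans (≈-sym g≈) g≈′) ωpb α ⟨
      lin ωpb (rescale ωsign L) α
    ≡⟨ lin-rescale ωpb ωsign L α ⟩
      lin (λ μ → ωsign μ ⊙ ωpb μ) L α
    ≡⟨ lin-cong (λ μ → ωsign-involutive μ (pb μ)) L α ⟩
      lin pb L α
    ≡⟨ f≈ α ⟨
      f α
    ∎
    where open ≡-Reasoning
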